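{- For every $n\in\mathbb{N}$ there exists a directed acyclic graph $D_n$ with $\operatorname{dbw}(D_n)\geq n$.
   Context: All digraphs are finite; $\vec{xy}$ denotes the directed edge from $x$ to $y$. Directed branch-width: for $B\subseteq E(D)$ let $S_B^V=\{y\in V(D): \exists x,z \text{ with } \vec{xy}\in E(D)\setminus B,\ \vec{yz}\in B\}$ and $f_D(X)=|S_X^V\cup S_{E(D)\setminus X}^V|$. A directed branch decomposition is a pair $(T,\beta)$ with $T$ a tree of maximum degree at most three and $\beta$ a bijection from the leaves of $T$ to $E(D)$. For an edge $xy$ of $T$, with $Y$ the set of leaves in the component of $T-xy$ containing $y$, its order is $f_D(\beta(Y))$. The width is the maximum order of an edge, and $\operatorname{dbw}(D)$ is the minimum width. -}

module Defs where

open import Data.Nat using (ℕ; zero; suc; _+_; _≤_)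
open import Data.Fin using (Fin)
open import Data.Fin.Properties using (_≟_)
open import Data.Product using (Σ; ∃; ∃-syntax; _×_; _,_; proj₁; proj₂)
open import Data.Sum using (_⊎_)
open import Data.List using (List; map; allFin)
open import Data.Nat.ListAction using (sum)
open import Data.Bool using (Bool; true; false; _∨_; if_then_else_)
open import Relation.Nullary using (¬_)
open import Relation.Nullary.Decidable using (⌊_⌋)
open import Relation.Binary.PropositionalEquality using (_≡_; _≢_)
open import Function.Definitions using (Injective)
open import Function.Bundles using (_⤖_)

-- Finite digraphs: vertex set Fin nV, edge set indexed by Fin nE,
-- edge i is the directed edge  tail i → head i.  Injectivity of the
-- edge map makes E(D) a subset of V × V (no parallel edges).

record Digraph : Set where
  field
    nV   : ℕ
    nE   : ℕ
    edge : Fin nE → Fin nV × Fin nV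
    edge-inj : Injective _≡_ _≡_ edge

  tail : Fin nE → Fin nV
  tail i = proj₁ (edge i)

  head : Fin nE → Fin nV
  head i = proj₂ (edge i)

open Digraph public

data Reach (D : Digraph) : Fin (nV D) → Fin (nV D) → Set where
  one  : ∀ i → Reach D (tail D i) (head D i)
  more : ∀ i {w} → Reach D (head D i) w → Reach D (tail D i) w

Acyclic : Digraph → Set
Acyclic D = ∀ v → ¬ Reach D v v

-- S^V_X for a set X ⊆ E(D) given as a predicate on edge indices:
-- vertices y with an edge x→y not in X and an edge y→z in X.
S : (D : Digraph) → (Fin (nE D) → Set) → Fin (nV D) → Set
S D X y = (∃[ a ] (¬ X a × head D a ≡ y)) × (∃[ b ] (X b × tail D b ≡ y))

Co : (D : Digraph) → (Fin (nE D) → Set) → Fin (nE D) → Set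
Co D X e = ¬ X e

InBoundary : (D : Digraph) → (Fin (nE D) → Set) → Fin (nV D) → Set
InBoundary D X y = S D X y ⊎ S D (Co D X) y

-- f_D(X) ≥ n : the set S_X ∪ S_{E∖X} has at least n elements,
-- i.e. there are n pairwise distinct vertices in it.
fAtLeast : (D : Digraph) → (Fin (nE D) → Set) → ℕ → Set
fAtLeast D X n =
  Σ (Fin n → Fin (nV D)) λ g → Injective _≡_ _≡_ g × (∀ k → InBoundary D X (g k))

-- Finite (undirected multi)graphs used as decomposition trees:
-- vertex set Fin k, edges indexed by Fin l with endpoints tEdge j.

data Walk {k l : ℕ} (tEdge : Fin l → Fin k × Fin k) (allowed : Fin l → Set)
       : Fin k → Fin k → Set where
  here : ∀ {a} → Walk tEdge allowed a a
  fwd  : ∀ j {b} → allowed j → Walk tEdge allowed (proj₂ (tEdge j)) b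
         → Walk tEdge allowed (proj₁ (tEdge j)) b
  bwd  : ∀ j {b} → allowed j → Walk tEdge allowed (proj₁ (tEdge j)) b
         → Walk tEdge allowed (proj₂ (tEdge j)) b

degree : {k l : ℕ} → (Fin l → Fin k × Fin k) → Fin k → ℕ
degree {k} {l} tEdge v =
  sum (map (λ j → if ⌊ proj₁ (tEdge j) ≟ v ⌋ ∨ ⌊ proj₂ (tEdge j) ≟ v ⌋
                  then 1 else 0) (allFin l))

IsTree : {k l : ℕ} → (Fin l → Fin k × Fin k) → Set
IsTree {k} {l} tEdge = (suc l ≡ k) × (∀ a b → Walk tEdge (λ _ → Data.Unit.⊤) a b)
  where import Data.Unit

record BranchDecomposition (D : Digraph) : Set₁ where
  field
    k     : ℕ
    l     : ℕ
    tEdge : Fin l → Fin k × Fin k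
    tree  : IsTree tEdge
    maxdeg : ∀ v → degree tEdge v ≤ 3
    β     : Σ (Fin k) (λ v → degree tEdge v ≤ 1) ⤖ Fin (nE D)

  Leaf : Set
  Leaf = Σ (Fin k) (λ v → degree tEdge v ≤ 1)

  -- For tree edge j = xy (x = proj₁, y = proj₂): β(Y), where Y is the
  -- set of leaves in the component of T − xy containing y.
  side : Fin l → Fin (nE D) → Set
  side j e = ∃[ ℓ ] (Function.Bundles.Bijection.to β ℓ ≡ e
                     × Walk tEdge (λ j' → j' ≢ j) (proj₂ (tEdge j)) (proj₁ ℓ))

  orderAtLeast : Fin l → ℕ → Set
  orderAtLeast j n = fAtLeast D (side j) n

  -- the width (max order over tree edges, 0 if there are none) is ≥ n
  widthAtLeast : ℕ → Set
  widthAtLeast n = (n ≡ 0) ⊎ (∃[ j ] orderAtLeast j n)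

-- dbw(D) ≥ n : decompositions exist (so dbw is defined) and every one
-- has width at least n.
dbwAtLeast : Digraph → ℕ → Set₁
dbwAtLeast D n =
  Σ (BranchDecomposition D) (λ _ → Data.Unit.⊤)
  × (∀ (T : BranchDecomposition D) → BranchDecomposition.widthAtLeast T n)
  where import Data.Unit

-- D consists of four layers of N = 3n + 3 vertices, with every arc from each layer to the next;
-- arcs increase the layer, so D is acyclic.  Suppose every edge of a branch decomposition has
-- order < n, and call a side of a cut small if each of its arcs touches the boundary of the cut.
-- If the boundary misses a vertex of layer 1 and one of layer 2, the arcs avoiding the boundary
-- are linked through these vertices, so they all lie on one side and the other side is small.
-- Orient every tree edge away from a small side and take a sink v.  The at most three cuts at v
-- and the leaf at v cover at most 3n + 2 vertices, so some arc from layer 1 to layer 2 avoids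
-- them all.  Its leaf lies behind one of the cuts at v, on a small side, yet touches no boundary.

module Submission where

open import Defs
open import Data.Bool using (_∨_; if_then_else_)
open import Data.Empty using (⊥; ⊥-elim)
open import Data.Fin using (Fin; zero; suc; toℕ; inject₁; inject≤; combine; remQuot; punchIn)
open import Data.Fin.Properties using (_≟_; any?; all?; ¬∀⟶∃¬; pigeonhole; <⇒≢; suc-injective; inject≤-injective; toℕ-inject₁; combine-injective; combine-injectiveʳ; remQuot-combine; combine-remQuot; punchIn-injective; punchInᵢ≢i)
open import Data.List using (List; []; _∷_; length; lookup; map; filter; allFin; concatMap; _++_)
open import Data.List.Membership.Propositional using (_∈_; _∉_)
open import Data.List.Membership.Propositional.Properties using (∈-filter⁺; ∈-filter⁻; ∈-allFin; ∈-lookup; ∈-++⁺ˡ; ∈-++⁺ʳ; ∈-concat⁺′; ∈-map⁺)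
open import Data.List.Properties using (length-++; length-tabulate; filter-notAll; map-tabulate; map-cong)
import Data.List.Relation.Unary.All as All
open import Data.List.Relation.Unary.AllPairs using ([]; _∷_)
open import Data.List.Relation.Unary.Any using (here; there)
import Data.List.Relation.Unary.Any as Any
open import Data.List.Relation.Unary.Any.Properties using (lookup-index)
open import Data.List.Relation.Unary.Unique.Propositional using (Unique)
open import Data.List.Relation.Unary.Unique.Propositional.Properties using (filter⁺; allFin⁺)
open import Data.Nat using (ℕ; zero; suc; pred; _+_; _*_; _≤_; _<_; _≤?_; z≤n; s≤s)
open import Data.Nat.ListAction using (sum)
open import Data.Nat.Properties using (≤-refl; ≤-trans; ≤-reflexive; ≤-irrelevant; ≤-pred; <-irrefl; <⇒≤; ≰⇒>; n≤1+n; m≤n⇒m≤1+n; m≤m+n; m≤n+m; +-suc; +-comm; +-mono-≤; +-monoʳ-≤; *-monoˡ-≤)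
open import Data.Product using (Σ; ∃; _×_; _,_; proj₁; proj₂; map₂; uncurry)
import Data.Product as Product
open import Data.Sum using (_⊎_; inj₁; inj₂)
open import Data.Unit using (⊤; tt)
open import Function using (_∘′_)
open import Function.Bundles using (_⤖_; mk⤖; module Bijection)
open import Function.Definitions using (Injective)
open import Relation.Binary.PropositionalEquality using (_≡_; _≢_; refl; sym; trans; cong; cong₂; subst; module ≡-Reasoning)
open import Relation.Nullary using (¬_; Dec; yes; no; ¬?)
open import Relation.Nullary.Decidable using (⌊_⌋; map′; _⊎-dec_; _×-dec_; _→-dec_)
open import Relation.Unary using (Decidable)

-- Walks in finite graphs and trees

module Walks {k l : ℕ} (ends : Fin l → Fin k × Fin k) where

  end₁ end₂ : Fin l → Fin k
  end₁ j = proj₁ (ends j)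
  end₂ j = proj₂ (ends j)

  Incident : Fin l → Fin k → Set
  Incident j v = end₁ j ≡ v ⊎ end₂ j ≡ v

  incident? : ∀ v j → Dec (Incident j v)
  incident? v j = (end₁ j ≟ v) ⊎-dec (end₂ j ≟ v)

  degree-as-count : ∀ v → degree ends v ≡ length (filter (incident? v) (allFin l))
  degree-as-count v = count (allFin l)
    where
    count : ∀ js → sum (map (λ j → if ⌊ end₁ j ≟ v ⌋ ∨ ⌊ end₂ j ≟ v ⌋ then 1 else 0) js)
                 ≡ length (filter (incident? v) js)
    count []       = refl
    count (j ∷ js) with end₁ j ≟ v | end₂ j ≟ v
    ... | yes _ | _     = cong suc (count js)
    ... | no _  | yes _ = cong suc (count js)
    ... | no _  | no _  = count js

  module _ {A : Fin l → Set} where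

    _++ʷ_ : ∀ {a b c} → Walk ends A a b → Walk ends A b c → Walk ends A a c
    here        ++ʷ q = q
    fwd j x p   ++ʷ q = fwd j x (p ++ʷ q)
    bwd j x p   ++ʷ q = bwd j x (p ++ʷ q)

    reverseʷ : ∀ {a b} → Walk ends A a b → Walk ends A b a
    reverseʷ here        = here
    reverseʷ (fwd j x p) = reverseʷ p ++ʷ bwd j x here
    reverseʷ (bwd j x p) = reverseʷ p ++ʷ fwd j x here

  mapʷ : ∀ {A B : Fin l → Set} {a b} → (∀ {j} → A j → B j) → Walk ends A a b → Walk ends B a b
  mapʷ f here        = here
  mapʷ f (fwd j x p) = fwd j (f x) (mapʷ f p)
  mapʷ f (bwd j x p) = bwd j (f x) (mapʷ f p)

  -- Adding the edges of a list one at a time makes walks decidable.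
  Through : List (Fin l) → Fin k → Fin k → Set
  Through js = Walk ends (_∈ js)

  through-[] : ∀ {a b} → Through [] a b → a ≡ b
  through-[] here        = refl
  through-[] (fwd j () p)
  through-[] (bwd j () p)

  ThroughVia : List (Fin l) → Fin l → Fin k → Fin k → Set
  ThroughVia js j a b = Through js a b
    ⊎ (Through js a (end₁ j) × Through js (end₂ j) b)
    ⊎ (Through js a (end₂ j) × Through js (end₁ j) b)

  private
    prepend : ∀ {js j a c b} → Through js a c → ThroughVia js j c b → ThroughVia js j a b
    prepend s (inj₁ q)               = inj₁ (s ++ʷ q)
    prepend s (inj₂ (inj₁ (q , r))) = inj₂ (inj₁ (s ++ʷ q , r))
    prepend s (inj₂ (inj₂ (q , r))) = inj₂ (inj₂ (s ++ʷ q , r))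

    cross₁ : ∀ {js j b} → ThroughVia js j (end₂ j) b → ThroughVia js j (end₁ j) b
    cross₁ (inj₁ q)               = inj₂ (inj₁ (here , q))
    cross₁ (inj₂ (inj₁ (q , r))) = inj₁ (reverseʷ q ++ʷ r)
    cross₁ (inj₂ (inj₂ (q , r))) = inj₁ r

    cross₂ : ∀ {js j b} → ThroughVia js j (end₁ j) b → ThroughVia js j (end₂ j) b
    cross₂ (inj₁ q)               = inj₂ (inj₂ (here , q))
    cross₂ (inj₂ (inj₁ (q , r))) = inj₁ r
    cross₂ (inj₂ (inj₂ (q , r))) = inj₁ (reverseʷ q ++ʷ r)

  through-∷⁻ : ∀ {js j a b} → Through (j ∷ js) a b → ThroughVia js j a b
  through-∷⁻ here                     = inj₁ here
  through-∷⁻ (fwd j (here refl) p)    = cross₁ (through-∷⁻ p)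
  through-∷⁻ (fwd j (there j∈) p)     = prepend (fwd j j∈ here) (through-∷⁻ p)
  through-∷⁻ (bwd j (here refl) p)    = cross₂ (through-∷⁻ p)
  through-∷⁻ (bwd j (there j∈) p)     = prepend (bwd j j∈ here) (through-∷⁻ p)

  through-∷⁺ : ∀ {js j a b} → ThroughVia js j a b → Through (j ∷ js) a b
  through-∷⁺ (inj₁ q)                         = mapʷ there q
  through-∷⁺ {j = j} (inj₂ (inj₁ (q , r))) = mapʷ there q ++ʷ fwd j (here refl) (mapʷ there r)
  through-∷⁺ {j = j} (inj₂ (inj₂ (q , r))) = mapʷ there q ++ʷ bwd j (here refl) (mapʷ there r)

  through? : ∀ js a b → Dec (Through js a b)
  through? []       a b = map′ (λ { refl → here }) through-[] (a ≟ b)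
  through? (j ∷ js) a b = map′ through-∷⁺ through-∷⁻
    (through? js a b
     ⊎-dec ((through? js a (end₁ j) ×-dec through? js (end₂ j) b)
     ⊎-dec (through? js a (end₂ j) ×-dec through? js (end₁ j) b)))

  walk? : {A : Fin l → Set} → Decidable A → ∀ a b → Dec (Walk ends A a b)
  walk? A? a b = map′ (mapʷ (λ j∈ → proj₂ (∈-filter⁻ A? {xs = allFin l} j∈)))
                      (mapʷ (λ {j} x → ∈-filter⁺ A? (∈-allFin j) x))
                      (through? (filter A? (allFin l)) a b)

  -- Adding an edge to js costs at most one of t mutually unreachable vertices.
  Scattered : List (Fin l) → Set
  Scattered js = Σ ℕ λ t → Σ (Fin t → Fin k) λ g →
    (∀ a b → a ≢ b → ¬ Through js (g a) (g b)) × (k ≤ t + length js)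

  scattered : ∀ js → Scattered js
  scattered [] = k , (λ x → x) , (λ a b a≢b p → a≢b (through-[] p)) , m≤m+n k 0
  scattered (j ∷ js) with scattered js
  ... | t , g , apart , k≤ with any? (λ i → through? js (g i) (end₂ j))
  ... | no none = t , g , apart′ , ≤-trans k≤ (+-monoʳ-≤ t (n≤1+n _))
    where
    apart′ : ∀ a b → a ≢ b → ¬ Through (j ∷ js) (g a) (g b)
    apart′ a b a≢b p with through-∷⁻ p
    ... | inj₁ q               = apart a b a≢b q
    ... | inj₂ (inj₁ (_ , r)) = none (b , reverseʷ r)
    ... | inj₂ (inj₂ (q , _)) = none (a , q)
  scattered (j ∷ js) | suc t , g , apart , k≤ | yes (i₀ , q₀) =
    t , (λ x → g (punchIn i₀ x)) , apart′ , subst (k ≤_) (sym (+-suc t (length js))) k≤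
    where
    apart′ : ∀ a b → a ≢ b → ¬ Through (j ∷ js) (g (punchIn i₀ a)) (g (punchIn i₀ b))
    apart′ a b a≢b p with through-∷⁻ p
    ... | inj₁ q               = apart _ _ (λ e → a≢b (punchIn-injective i₀ a b e)) q
    ... | inj₂ (inj₁ (_ , r)) = apart i₀ _ (λ e → punchInᵢ≢i i₀ b (sym e)) (q₀ ++ʷ r)
    ... | inj₂ (inj₂ (q , _)) = apart i₀ _ (λ e → punchInᵢ≢i i₀ a (sym e)) (q₀ ++ʷ reverseʷ q)

  connected⇒≤ : ∀ js → (∀ a b → Through js a b) → k ≤ suc (length js)
  connected⇒≤ js conn with scattered js
  ... | zero          , _ , _     , k≤ = m≤n⇒m≤1+n k≤
  ... | suc zero      , _ , _     , k≤ = k≤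
  ... | suc (suc _)   , _ , apart , _  = ⊥-elim (apart zero (suc zero) (λ ()) (conn _ _))

  Avoiding : Fin l → Fin l → Set
  Avoiding j j′ = j′ ≢ j

  avoiding? : ∀ j → Decidable (Avoiding j)
  avoiding? j j′ = ¬? (j′ ≟ j)

  cut-disconnects : IsTree ends → ∀ j → ¬ Walk ends (Avoiding j) (end₁ j) (end₂ j)
  cut-disconnects (refl , conn) j bypass = <-irrefl refl (≤-trans fewer (≤-pred (connected⇒≤ js conn′)))
    where
    js = filter (avoiding? j) (allFin l)
    detour : ∀ {A a b} → Walk ends A a b → Walk ends (Avoiding j) a b
    detour here = here
    detour (fwd j′ _ p) with j′ ≟ j
    ... | yes refl = bypass ++ʷ detour p
    ... | no j′≢j  = fwd j′ j′≢j (detour p)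
    detour (bwd j′ _ p) with j′ ≟ j
    ... | yes refl = reverseʷ bypass ++ʷ detour p
    ... | no j′≢j  = bwd j′ j′≢j (detour p)
    conn′ : ∀ a b → Through js a b
    conn′ a b = mapʷ (λ {j′} j′≢j → ∈-filter⁺ (avoiding? j) (∈-allFin j′) j′≢j) (detour (conn a b))
    fewer : length js < l
    fewer = subst (length js <_) (length-tabulate (λ x → x))
              (filter-notAll (avoiding? j) (allFin l) (Any.map (λ { refl j≢j → j≢j refl }) (∈-allFin j)))

  tree-loopless : IsTree ends → ∀ j → end₁ j ≢ end₂ j
  tree-loopless tree j e = cut-disconnects tree j (subst (Walk ends (Avoiding j) (end₁ j)) e here)

  module _ (v : Fin k) where

    Off : Fin l → Set
    Off j = ¬ Incident j v

    LastExit : Fin k → Set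
    LastExit u = u ≡ v ⊎ ∃ λ j → (end₁ j ≡ v × Walk ends Off (end₂ j) u)
                                ⊎ (end₂ j ≡ v × Walk ends Off (end₁ j) u)

    private
      off-at-v : ∀ {a u} → a ≡ v → Walk ends Off a u → u ≡ v
      off-at-v a≡v here        = a≡v
      off-at-v a≡v (fwd j o p) = ⊥-elim (o (inj₁ a≡v))
      off-at-v a≡v (bwd j o p) = ⊥-elim (o (inj₂ a≡v))

    last-exit : ∀ {A a u} → Walk ends A a u → Walk ends Off a u ⊎ LastExit u
    last-exit here = inj₁ here
    last-exit (fwd j _ p) with last-exit p
    ... | inj₂ exit = inj₂ exit
    ... | inj₁ q with end₁ j ≟ v | end₂ j ≟ v
    ...   | yes e₁ | _      = inj₂ (inj₂ (j , inj₁ (e₁ , q)))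
    ...   | no _   | yes e₂ = inj₂ (inj₁ (off-at-v e₂ q))
    ...   | no n₁  | no n₂  = inj₁ (fwd j (λ { (inj₁ e) → n₁ e ; (inj₂ e) → n₂ e }) q)
    last-exit (bwd j _ p) with last-exit p
    ... | inj₂ exit = inj₂ exit
    ... | inj₁ q with end₂ j ≟ v | end₁ j ≟ v
    ...   | yes e₂ | _      = inj₂ (inj₂ (j , inj₂ (e₂ , q)))
    ...   | no _   | yes e₁ = inj₂ (inj₁ (off-at-v e₁ q))
    ...   | no n₂  | no n₁  = inj₁ (bwd j (λ { (inj₁ e) → n₁ e ; (inj₂ e) → n₂ e }) q)

    last-exit-from : ∀ {A u} → Walk ends A v u → LastExit u
    last-exit-from p with last-exit p
    ... | inj₁ q    = inj₁ (off-at-v refl q)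
    ... | inj₂ exit = exit

    off⇒avoiding : ∀ {j a u} → Incident j v → Walk ends Off a u → Walk ends (Avoiding j) a u
    off⇒avoiding j∋v = mapʷ (λ { o refl → o j∋v })

  IsOrientation : (Fin l → Fin k) → Set
  IsOrientation h = ∀ j → h j ≡ end₁ j ⊎ h j ≡ end₂ j

  IsSink : (Fin l → Fin k) → Fin k → Set
  IsSink h v = ∀ j → Incident j v → h j ≡ v

  private
    tail-unique : ∀ (h : Fin l → Fin k) j {x y} → h j ≡ end₁ j ⊎ h j ≡ end₂ j →
                  Incident j x → h j ≢ x → Incident j y → h j ≢ y → x ≡ y
    tail-unique _ _ _             (inj₁ refl) _   (inj₁ refl) _   = refl
    tail-unique _ _ _             (inj₂ refl) _   (inj₂ refl) _   = refl
    tail-unique _ _ (inj₁ h≡)     (inj₁ refl) h≢x _           _   = ⊥-elim (h≢x h≡)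
    tail-unique _ _ (inj₂ h≡)     (inj₁ refl) _   (inj₂ refl) h≢y = ⊥-elim (h≢y h≡)
    tail-unique _ _ (inj₁ h≡)     (inj₂ refl) _   (inj₁ refl) h≢y = ⊥-elim (h≢y h≡)
    tail-unique _ _ (inj₂ h≡)     (inj₂ refl) h≢x _           _   = ⊥-elim (h≢x h≡)

  -- Otherwise picking at every vertex an edge whose head lies elsewhere is injective, contradicting l < k.
  sink-exists : ∀ h → IsOrientation h → l < k → ∃ (IsSink h)
  sink-exists h orient l<k with any? (λ v → all? (λ j → incident? v j →-dec (h j ≟ v)))
  ... | yes sink = sink
  ... | no nosink = ⊥-elim (<⇒≢ i<i′ (tail-unique h (out i) (orient (out i)) (out-incident i) (out-not-head i)
                                                     (subst (λ j → Incident j i′) (sym same) (out-incident i′))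
                                                     (subst (λ j → h j ≢ i′) (sym same) (out-not-head i′))))
    where
    bad : ∀ v → ∃ λ j → ¬ (Incident j v → h j ≡ v)
    bad v = ¬∀⟶∃¬ l _ (λ j → incident? v j →-dec (h j ≟ v)) (λ s → nosink (v , s))
    out : Fin k → Fin l
    out v = proj₁ (bad v)
    out-incident : ∀ v → Incident (out v) v
    out-incident v with incident? v (out v)
    ... | yes inc = inc
    ... | no ¬inc = ⊥-elim (proj₂ (bad v) (λ inc → ⊥-elim (¬inc inc)))
    out-not-head : ∀ v → h (out v) ≢ v
    out-not-head v e = proj₂ (bad v) (λ _ → e)
    collision = pigeonhole l<k out
    i = proj₁ collision
    i′ = proj₁ (proj₂ collision)
    i<i′ = proj₁ (proj₂ (proj₂ collision))
    same = proj₂ (proj₂ (proj₂ collision))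

-- Counting

length-concatMap-≤ : ∀ {A B : Set} (f : A → List B) {m} → (∀ x → length (f x) ≤ m) →
                     ∀ xs → length (concatMap f xs) ≤ length xs * m
length-concatMap-≤ f bound []       = z≤n
length-concatMap-≤ f bound (x ∷ xs) =
  subst (_≤ _) (sym (length-++ (f x))) (+-mono-≤ (bound x) (length-concatMap-≤ f bound xs))

lookup-injective : ∀ {A : Set} {xs : List A} → Unique xs → ∀ {i j} → lookup xs i ≡ lookup xs j → i ≡ j
lookup-injective (_  ∷ _) {zero}  {zero}  _  = refl
lookup-injective (x∉ ∷ _) {zero}  {suc j} eq = ⊥-elim (All.lookup x∉ (∈-lookup j) eq)
lookup-injective (x∉ ∷ _) {suc i} {zero}  eq = ⊥-elim (All.lookup x∉ (∈-lookup i) (sym eq))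
lookup-injective (_  ∷ u) {suc i} {suc j} eq = cong suc (lookup-injective u eq)

injection-from-filter : ∀ {m n} {P : Fin m → Set} (P? : Decidable P) → n ≤ length (filter P? (allFin m)) →
                        Σ (Fin n → Fin m) λ g → Injective _≡_ _≡_ g × (∀ i → P (g i))
injection-from-filter {m} P? n≤ =
  g , (λ {a} {b} eq → inject≤-injective n≤ n≤ a b (lookup-injective (filter⁺ P? (allFin⁺ m)) eq)) ,
  (λ i → proj₂ (∈-filter⁻ P? {xs = allFin m} (∈-lookup (inject≤ i n≤))))
  where
  g : _ → Fin m
  g i = lookup (filter P? (allFin m)) (inject≤ i n≤)

missing-from-short-list : ∀ {N m} (g : Fin N → Fin m) → Injective _≡_ _≡_ g →
                          ∀ (L : List (Fin m)) → length L < N → ∃ λ i → g i ∉ L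
missing-from-short-list {N} g g-inj L short = ¬∀⟶∃¬ N _ (λ i → Any.any? (g i ≟_) L) all-in
  where
  all-in : ¬ (∀ i → g i ∈ L)
  all-in g∈ with pigeonhole short (λ i → Any.index (g∈ i))
  ... | i , j , i<j , same =
    <⇒≢ i<j (g-inj (trans (lookup-index (g∈ i)) (trans (cong (lookup L) same) (sym (lookup-index (g∈ j))))))

-- Separations of the arcs of a digraph

module Separation (D : Digraph) {X : Fin (nE D) → Set} (X? : Decidable X) where

  Boundary : Fin (nV D) → Set
  Boundary = InBoundary D X

  boundary? : Decidable Boundary
  boundary? y = S? X X? ⊎-dec S? (Co D X) (λ e → ¬? (X? e))
    where
    S? : (Y : Fin (nE D) → Set) → Decidable Y → Dec (S D Y y)
    S? Y Y? = any? (λ a → ¬? (Y? a) ×-dec (head D a ≟ y)) ×-dec any? (λ b → Y? b ×-dec (tail D b ≟ y))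

  Touches : Fin (nE D) → Set
  Touches e = Boundary (tail D e) ⊎ Boundary (head D e)

  touches? : Decidable Touches
  touches? e = boundary? (tail D e) ⊎-dec boundary? (head D e)

  Small : Set
  Small = ∀ e → X e → Touches e

  Meets : Fin (nE D) → Fin (nV D) → Set
  Meets e y = head D e ≡ y ⊎ tail D e ≡ y

  private
    in→out : ∀ {y a b} → ¬ Boundary y → head D a ≡ y → tail D b ≡ y → X a → X b
    in→out {b = b} y∉ ha tb xa with X? b
    ... | yes xb = xb
    ... | no ¬xb = ⊥-elim (y∉ (inj₂ ((_ , (λ ¬xa → ¬xa xa) , ha) , (b , ¬xb , tb))))

    out→in : ∀ {y a b} → ¬ Boundary y → head D a ≡ y → tail D b ≡ y → X b → X a
    out→in {a = a} y∉ ha tb xb with X? a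
    ... | yes xa = xa
    ... | no ¬xa = ⊥-elim (y∉ (inj₁ ((a , ¬xa , ha) , (_ , xb , tb))))

  uniform : ∀ {y} aᵢ aₒ → head D aᵢ ≡ y → tail D aₒ ≡ y → ¬ Boundary y →
            ∀ {a b} → Meets a y → Meets b y → X a → X b
  uniform aᵢ aₒ hᵢ tₒ y∉ (inj₁ ha) (inj₁ hb) = out→in y∉ hb tₒ ∘′ in→out y∉ ha tₒ
  uniform aᵢ aₒ hᵢ tₒ y∉ (inj₁ ha) (inj₂ tb) = in→out y∉ ha tb
  uniform aᵢ aₒ hᵢ tₒ y∉ (inj₂ ta) (inj₁ hb) = out→in y∉ hb ta
  uniform aᵢ aₒ hᵢ tₒ y∉ (inj₂ ta) (inj₂ tb) = in→out y∉ hᵢ tb ∘′ out→in y∉ hᵢ ta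

-- The layered digraph

-- Four layers of N vertices; arc c i j joins vertex i of layer c to vertex j of layer c + 1.
module Layered (N : ℕ) where

  vertex : Fin 4 → Fin N → Fin (4 * N)
  vertex = combine

  arc : Fin 3 → Fin N → Fin N → Fin (3 * (N * N))
  arc c i j = combine c (combine i j)

  Arc : Set
  Arc = Fin 3 × Fin N × Fin N

  encode : Arc → Fin (3 * (N * N))
  encode (c , i , j) = arc c i j

  decode : Fin (3 * (N * N)) → Arc
  decode e = map₂ (remQuot {N} N) (remQuot {3} (N * N) e)

  encode-decode : ∀ e → encode (decode e) ≡ e
  encode-decode e = begin
    combine c (uncurry combine (remQuot {N} N ij)) ≡⟨ cong (combine c) (combine-remQuot {N} N ij) ⟩
    uncurry combine (remQuot {3} (N * N) e)    ≡⟨ combine-remQuot {3} (N * N) e ⟩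
    e                                          ∎
    where
    open ≡-Reasoning
    c = proj₁ (remQuot {3} (N * N) e)
    ij = proj₂ (remQuot {3} (N * N) e)

  decode-arc : ∀ c i j → decode (arc c i j) ≡ (c , i , j)
  decode-arc c i j = begin
    decode (arc c i j)                 ≡⟨ cong (map₂ (remQuot {N} N)) (remQuot-combine c (combine i j)) ⟩
    (c , remQuot {N} N (combine i j)) ≡⟨ cong (c ,_) (remQuot-combine i j) ⟩
    (c , i , j)                        ∎
    where open ≡-Reasoning

  ends : Arc → Fin (4 * N) × Fin (4 * N)
  ends (c , i , j) = vertex (inject₁ c) i , vertex (suc c) j

  ends-injective : ∀ {a b} → ends a ≡ ends b → a ≡ b
  ends-injective {c , i , j} {c′ , i′ , j′} eq
    with refl , refl ← combine-injective (inject₁ c) i (inject₁ c′) i′ (cong proj₁ eq)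
       | refl , refl ← combine-injective (suc c) j (suc c′) j′ (cong proj₂ eq) = refl

  D : Digraph
  D = record
    { nV = 4 * N
    ; nE = 3 * (N * N)
    ; edge = ends ∘′ decode
    ; edge-inj = λ {e} {e′} eq → begin
        e                 ≡⟨ sym (encode-decode e) ⟩
        encode (decode e)  ≡⟨ cong encode (ends-injective {decode e} {decode e′} eq) ⟩
        encode (decode e′) ≡⟨ encode-decode e′ ⟩
        e′                 ∎
    }
    where open ≡-Reasoning

  tail-arc : ∀ c i j → tail D (arc c i j) ≡ vertex (inject₁ c) i
  tail-arc c i j = cong (proj₁ ∘′ ends) (decode-arc c i j)

  head-arc : ∀ c i j → head D (arc c i j) ≡ vertex (suc c) j
  head-arc c i j = cong (proj₂ ∘′ ends) (decode-arc c i j)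

  data ArcView : Fin (nE D) → Set where
    arc-view : ∀ c i j → ArcView (arc c i j)

  view : ∀ e → ArcView e
  view e = subst ArcView (encode-decode e) (arc-view c i j)
    where
    c = proj₁ (decode e)
    i = proj₁ (proj₂ (decode e))
    j = proj₂ (proj₂ (decode e))

  layer : Fin (nV D) → ℕ
  layer v = toℕ (proj₁ (remQuot {4} N v))

  layer-vertex : ∀ c i → layer (vertex c i) ≡ toℕ c
  layer-vertex c i = cong (toℕ ∘′ proj₁) (remQuot-combine c i)

  layer-increases : ∀ e → layer (tail D e) < layer (head D e)
  layer-increases e with view e
  ... | arc-view c i j rewrite tail-arc c i j | head-arc c i j
                             | layer-vertex (inject₁ c) i | layer-vertex (suc c) j | toℕ-inject₁ c = s≤s ≤-refl

  reach-increases : ∀ {u w} → Reach D u w → layer u < layer w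
  reach-increases (one e)    = layer-increases e
  reach-increases (more e r) = ≤-trans (layer-increases e) (≤-trans (n≤1+n _) (reach-increases r))

  acyclic : Acyclic D
  acyclic v r = <-irrefl refl (reach-increases r)

  inner : Fin 2 → Fin N → Fin (nV D)
  inner c = vertex (suc (inject₁ c))

  inner-injective : ∀ c → Injective _≡_ _≡_ (inner c)
  inner-injective c {a} {b} = combine-injectiveʳ (suc (inject₁ c)) a (suc (inject₁ c)) b

  module _ {X : Fin (nE D) → Set} (X? : Decidable X) where
    open Separation D X?

    uniform-inner : ∀ c p → ¬ Boundary (inner c p) →
                    ∀ {a b} → Meets a (inner c p) → Meets b (inner c p) → X a → X b
    uniform-inner c p =
      uniform (arc (inject₁ c) p p) (arc (suc c) p p) (head-arc (inject₁ c) p p) (tail-arc (suc c) p p)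

    -- An arc has an end in layer 1 or 2, and one more arc links that end to an end of arc 1 i i′.
    untouched⇒free-arc : ∀ {i i′} → ¬ Boundary (inner zero i) → ¬ Boundary (inner (suc zero) i′) →
           ∀ a → ¬ Touches a → X a → X (arc (suc zero) i i′)
    untouched⇒free-arc {i} {i′} i∉ i′∉ a a-free with view a
    ... | arc-view zero p q =
      uniform-inner (suc zero) i′ i′∉ (inj₁ (head-arc (suc zero) q i′)) (inj₁ (head-arc (suc zero) i i′))
      ∘′ uniform-inner zero q (λ b → a-free (inj₂ (subst Boundary (sym (head-arc zero p q)) b)))
           (inj₁ (head-arc zero p q)) (inj₂ (tail-arc (suc zero) q i′))
    ... | arc-view (suc zero) p q =
      uniform-inner (suc zero) i′ i′∉ (inj₁ (head-arc (suc zero) p i′)) (inj₁ (head-arc (suc zero) i i′))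
      ∘′ uniform-inner zero p (λ b → a-free (inj₁ (subst Boundary (sym (tail-arc (suc zero) p q)) b)))
           (inj₂ (tail-arc (suc zero) p q)) (inj₂ (tail-arc (suc zero) p i′))
    ... | arc-view (suc (suc zero)) p q =
      uniform-inner zero i i∉ (inj₂ (tail-arc (suc zero) i p)) (inj₂ (tail-arc (suc zero) i i′))
      ∘′ uniform-inner (suc zero) p (λ b → a-free (inj₁ (subst Boundary (sym (tail-arc (suc (suc zero)) p q)) b)))
           (inj₂ (tail-arc (suc (suc zero)) p q)) (inj₁ (head-arc (suc zero) i p))

    free-arc∉⇒small : ∀ {i i′} → ¬ Boundary (inner zero i) → ¬ Boundary (inner (suc zero) i′) →
                            ¬ X (arc (suc zero) i i′) → Small
    free-arc∉⇒small i∉ i′∉ ¬x a xa with touches? a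
    ... | yes t = t
    ... | no ¬t = ⊥-elim (¬x (untouched⇒free-arc i∉ i′∉ a ¬t xa))

-- Branch decompositions

module Placement {D : Digraph} (T : BranchDecomposition D) where
  open BranchDecomposition T
  open Walks tEdge
  open Bijection β using (to; injective; surjective)

  leaf-of : Fin (nE D) → Leaf
  leaf-of e = proj₁ (surjective e)

  to-leaf-of : ∀ e → to (leaf-of e) ≡ e
  to-leaf-of e = proj₂ (surjective e) refl

  side-leaf-of : ∀ {j e} → side j e → Walk tEdge (Avoiding j) (end₂ j) (proj₁ (leaf-of e))
  side-leaf-of {j} {e} (ℓ , toℓ≡e , w) =
    subst (λ ℓ → Walk tEdge (Avoiding j) (end₂ j) (proj₁ ℓ)) (injective (trans toℓ≡e (sym (to-leaf-of e)))) w

  side? : ∀ j → Decidable (side j)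
  side? j e with walk? (avoiding? j) (end₂ j) (proj₁ (leaf-of e))
  ... | yes w = yes (leaf-of e , to-leaf-of e , w)
  ... | no ¬w = no (¬w ∘′ side-leaf-of)

  -- e lies in the component of T − j not containing v
  Beyond : Fin k → Fin l → Fin (nE D) → Set
  Beyond v j e = (end₁ j ≡ v × side j e) ⊎ (end₂ j ≡ v × ¬ side j e)

  placement : ∀ v e → proj₁ (leaf-of e) ≡ v ⊎ ∃ λ j → Beyond v j e
  placement v e with last-exit-from v (proj₂ tree v (proj₁ (leaf-of e)))
  ... | inj₁ at-v = inj₁ at-v
  ... | inj₂ (j , inj₁ (e₁ , w)) = inj₂ (j , inj₁ (e₁ , leaf-of e , to-leaf-of e , off⇒avoiding v (inj₁ e₁) w))
  ... | inj₂ (j , inj₂ (e₂ , w)) = inj₂ (j , inj₂ (e₂ , λ s →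
          cut-disconnects tree j (off⇒avoiding v (inj₂ e₂) w ++ʷ reverseʷ (side-leaf-of s))))

  arcs-at : Fin k → List (Fin (nE D))
  arcs-at v with degree tEdge v ≤? 1
  ... | yes leaf = to (v , leaf) ∷ []
  ... | no _     = []

  arcs-at-complete : ∀ v e → proj₁ (leaf-of e) ≡ v → e ∈ arcs-at v
  arcs-at-complete v e refl with degree tEdge v ≤? 1
  ... | yes leaf = here (trans (sym (to-leaf-of e)) (cong (λ p → to (v , p)) (≤-irrelevant _ leaf)))
  ... | no ¬leaf = ⊥-elim (¬leaf (proj₂ (leaf-of e)))

  length-arcs-at : ∀ v → length (arcs-at v) ≤ 1
  length-arcs-at v with degree tEdge v ≤? 1
  ... | yes _ = ≤-refl
  ... | no _  = z≤n

-- Caterpillars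

-- Grow a tree by a new root 0 with a new leaf 1, hanging the old root (now 2) below it.
grow : ∀ {k l} → (Fin l → Fin (suc k) × Fin (suc k)) →
       Fin (suc (suc l)) → Fin (suc (suc (suc k))) × Fin (suc (suc (suc k)))
grow ends zero          = zero , suc zero
grow ends (suc zero)    = suc (suc zero) , zero
grow ends (suc (suc j)) = Product.map (λ v → suc (suc v)) (λ v → suc (suc v)) (ends j)

spine : ℕ → ℕ
spine zero    = 0
spine (suc m) = suc (suc (spine m))

caterpillar : ∀ m → Fin (spine m) → Fin (suc (spine m)) × Fin (suc (spine m))
caterpillar zero    ()
caterpillar (suc m) = grow (caterpillar m)

isZero : ∀ {k} → Fin k → ℕ
isZero zero    = 1
isZero (suc _) = 0

caterpillar-degree : ∀ m → Fin (suc (spine m)) → ℕ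
caterpillar-degree zero    zero                = 0
caterpillar-degree (suc m) zero                = 2
caterpillar-degree (suc m) (suc zero)          = 1
caterpillar-degree (suc m) (suc (suc w))       = isZero w + caterpillar-degree m w

leaf : ∀ m → Fin (suc m) → Fin (suc (spine m))
leaf zero    zero    = zero
leaf (suc m) zero    = suc zero
leaf (suc m) (suc i) = suc (suc (leaf m i))

private
  incidence : ∀ {k l} → (Fin l → Fin k × Fin k) → Fin k → Fin l → ℕ
  incidence ends v j = if ⌊ proj₁ (ends j) ≟ v ⌋ ∨ ⌊ proj₂ (ends j) ≟ v ⌋ then 1 else 0

  degree-split : ∀ {k l} (ends : Fin (suc (suc l)) → Fin k × Fin k) v →
                 degree ends v
                 ≡ incidence ends v zero + (incidence ends v (suc zero) + degree (λ j → ends (suc (suc j))) v)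
  degree-split {l = l} ends v = cong (λ xs → incidence ends v zero + (incidence ends v (suc zero) + sum xs))
    (trans (map-tabulate (λ j → suc (suc j)) (incidence ends v))
           (sym (map-tabulate (λ j → j) (λ j → incidence ends v (suc (suc j))))))

  ⌊suc≟suc⌋ : ∀ {k} (x y : Fin k) → ⌊ suc x ≟ suc y ⌋ ≡ ⌊ x ≟ y ⌋
  ⌊suc≟suc⌋ x y with x ≟ y
  ... | yes _ = refl
  ... | no _  = refl

  degree-shift : ∀ {k l} (ends : Fin l → Fin k × Fin k) w →
                 degree (λ j → Product.map (λ v → suc (suc v)) (λ v → suc (suc v)) (ends j)) (suc (suc w))
                 ≡ degree ends w
  degree-shift {l = l} ends w = cong sum (map-cong (λ j → cong₂ (λ a b → if a ∨ b then 1 else 0)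
    (⌊suc²≟suc²⌋ (proj₁ (ends j))) (⌊suc²≟suc²⌋ (proj₂ (ends j)))) (allFin l))
    where
    ⌊suc²≟suc²⌋ : ∀ x → ⌊ suc (suc x) ≟ suc (suc w) ⌋ ≡ ⌊ x ≟ w ⌋
    ⌊suc²≟suc²⌋ x = trans (⌊suc≟suc⌋ (suc x) (suc w)) (⌊suc≟suc⌋ x w)

  sum-zeros : ∀ {A : Set} (xs : List A) → sum (map (λ _ → 0) xs) ≡ 0
  sum-zeros []       = refl
  sum-zeros (_ ∷ xs) = sum-zeros xs

degree-caterpillar : ∀ m v → degree (caterpillar m) v ≡ caterpillar-degree m v
degree-caterpillar zero    zero          = refl
degree-caterpillar (suc m) zero          = trans (degree-split (caterpillar (suc m)) zero)
  (cong (2 +_) (sum-zeros (allFin (spine m))))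
degree-caterpillar (suc m) (suc zero)    = trans (degree-split (caterpillar (suc m)) (suc zero))
  (cong (1 +_) (sum-zeros (allFin (spine m))))
degree-caterpillar (suc m) (suc (suc zero))    = trans (degree-split (caterpillar (suc m)) (suc (suc zero)))
  (cong suc (trans (degree-shift (caterpillar m) zero) (degree-caterpillar m zero)))
degree-caterpillar (suc m) (suc (suc (suc w))) = trans (degree-split (caterpillar (suc m)) (suc (suc (suc w))))
  (trans (degree-shift (caterpillar m) (suc w)) (degree-caterpillar m (suc w)))

caterpillar-degree-root-≤2 : ∀ m → caterpillar-degree m zero ≤ 2
caterpillar-degree-root-≤2 zero    = z≤n
caterpillar-degree-root-≤2 (suc m) = ≤-refl

caterpillar-degree-≤3 : ∀ m v → caterpillar-degree m v ≤ 3
caterpillar-degree-≤3 zero    zero                = z≤n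
caterpillar-degree-≤3 (suc m) zero                = s≤s (s≤s z≤n)
caterpillar-degree-≤3 (suc m) (suc zero)          = s≤s z≤n
caterpillar-degree-≤3 (suc m) (suc (suc zero))    = s≤s (caterpillar-degree-root-≤2 m)
caterpillar-degree-≤3 (suc m) (suc (suc (suc w))) = caterpillar-degree-≤3 m (suc w)

leaf-degree : ∀ m i → caterpillar-degree m (leaf m i) ≤ 1
leaf-degree zero          zero          = z≤n
leaf-degree (suc m)       zero          = ≤-refl
leaf-degree (suc zero)    (suc zero)    = ≤-refl
leaf-degree (suc (suc m)) (suc zero)    = ≤-refl
leaf-degree (suc (suc m)) (suc (suc i)) = leaf-degree (suc m) (suc i)

leaf-injective : ∀ m → Injective _≡_ _≡_ (leaf m)
leaf-injective zero    {zero}  {zero}  _  = refl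
leaf-injective (suc m) {zero}  {zero}  _  = refl
leaf-injective (suc m) {suc i} {suc j} eq = cong suc (leaf-injective m (suc-injective (suc-injective eq)))

leaf-complete : ∀ m v → caterpillar-degree m v ≤ 1 → ∃ λ i → leaf m i ≡ v
leaf-complete zero    zero          _ = zero , refl
leaf-complete (suc m) zero          (s≤s ())
leaf-complete (suc m) (suc zero)    _ = zero , refl
leaf-complete (suc m) (suc (suc w)) d with leaf-complete m w (≤-trans (m≤n+m _ (isZero w)) d)
... | i , refl = suc i , refl

caterpillar-connected : ∀ m v → Walk (caterpillar m) (λ _ → ⊤) v zero
caterpillar-connected zero    zero          = here
caterpillar-connected (suc m) zero          = here
caterpillar-connected (suc m) (suc zero)    = bwd zero tt here
caterpillar-connected (suc m) (suc (suc w)) = lift (caterpillar-connected m w) ++ʷ fwd (suc zero) tt here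
  where
  open Walks (caterpillar (suc m))
  lift : ∀ {a b} → Walk (caterpillar m) (λ _ → ⊤) a b →
         Walk (caterpillar (suc m)) (λ _ → ⊤) (suc (suc a)) (suc (suc b))
  lift here        = here
  lift (fwd j _ p) = fwd (suc (suc j)) tt (lift p)
  lift (bwd j _ p) = bwd (suc (suc j)) tt (lift p)

caterpillar-is-tree : ∀ m → IsTree (caterpillar m)
caterpillar-is-tree m = refl , λ a b → caterpillar-connected m a ++ʷ reverseʷ (caterpillar-connected m b)
  where open Walks (caterpillar m)

caterpillar-leaves : ∀ m → Σ (Fin (suc (spine m))) (λ v → degree (caterpillar m) v ≤ 1) ⤖ Fin (suc m)
caterpillar-leaves m = mk⤖ {to = index}
  (index-injective , λ i → (leaf m i , leaf-degree′ i) , λ { refl → leaf-injective m (proj₂ (leaf-complete m _ _)) })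
  where
  leaf-degree′ : ∀ i → degree (caterpillar m) (leaf m i) ≤ 1
  leaf-degree′ i = subst (_≤ 1) (sym (degree-caterpillar m (leaf m i))) (leaf-degree m i)
  index : Σ _ (λ v → degree (caterpillar m) v ≤ 1) → Fin (suc m)
  index (v , d) = proj₁ (leaf-complete m v (subst (_≤ 1) (degree-caterpillar m v) d))
  leaf-index : ∀ x → leaf m (index x) ≡ proj₁ x
  leaf-index (v , d) = proj₂ (leaf-complete m v _)
  index-injective : Injective _≡_ _≡_ index
  index-injective {v , d} {v′ , d′} eq
    with refl ← trans (sym (leaf-index (v , d))) (trans (cong (leaf m) eq) (leaf-index (v′ , d′)))
    = cong (v ,_) (≤-irrelevant d d′)

caterpillar-decomposition : ∀ (D : Digraph) {m} → nE D ≡ suc m → BranchDecomposition D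
caterpillar-decomposition D {m} eq = record
  { k      = suc (spine m)
  ; l      = spine m
  ; tEdge  = caterpillar m
  ; tree   = caterpillar-is-tree m
  ; maxdeg = λ v → subst (_≤ 3) (sym (degree-caterpillar m v)) (caterpillar-degree-≤3 m v)
  ; β      = subst (λ e → _ ⤖ Fin e) (sym eq) (caterpillar-leaves m)
  }

-- The width bound

module LowerBound (n N : ℕ) (N-large : 3 * n + 2 < N) where
  open Layered N

  module _ (T : BranchDecomposition D) where
    open BranchDecomposition T
    open Walks tEdge
    open Placement T

    module Cut (j : Fin l) = Separation D (side? j)

    cut-boundary : Fin l → List (Fin (nV D))
    cut-boundary j = filter (Cut.boundary? j) (allFin (nV D))

    module Thin (thin : ∀ j → length (cut-boundary j) < n) where

      small? : ∀ j → Dec (Cut.Small j)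
      small? j = all? (λ e → side? j e →-dec Cut.touches? j e)

      -- Each tree edge points away from its small side.
      toward : ∀ j → Dec (Cut.Small j) → Fin k
      toward j (yes _) = end₁ j
      toward j (no _)  = end₂ j

      toward-end : ∀ j d → toward j d ≡ end₁ j ⊎ toward j d ≡ end₂ j
      toward-end j (yes _) = inj₁ refl
      toward-end j (no _)  = inj₂ refl

      orientation : IsOrientation (λ j → toward j (small? j))
      orientation j = toward-end j (small? j)

      sink : ∃ (IsSink (λ j → toward j (small? j)))
      sink = sink-exists _ orientation (subst (l <_) (proj₁ tree) ≤-refl)

      v : Fin k
      v = proj₁ sink

      sink-side : ∀ j → Incident j v → (Cut.Small j × end₁ j ≡ v) ⊎ (¬ Cut.Small j × end₂ j ≡ v)
      sink-side j inc = cases (small? j) (proj₂ sink j inc)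
        where
        cases : ∀ d → toward j d ≡ v → (Cut.Small j × end₁ j ≡ v) ⊎ (¬ Cut.Small j × end₂ j ≡ v)
        cases (yes small) e = inj₁ (small , e)
        cases (no ¬small) e = inj₂ (¬small , e)

      near-cuts near-leaf near : List (Fin (nV D))
      near-cuts = concatMap cut-boundary (filter (incident? v) (allFin l))
      near-leaf = concatMap (λ e → tail D e ∷ head D e ∷ []) (arcs-at v)
      near      = near-cuts ++ near-leaf

      boundary⊆near : ∀ j → Incident j v → ∀ {y} → Cut.Boundary j y → y ∈ near
      boundary⊆near j inc b = ∈-++⁺ˡ (∈-concat⁺′ (∈-filter⁺ (Cut.boundary? j) (∈-allFin _) b)
                                                  (∈-map⁺ cut-boundary (∈-filter⁺ (incident? v) (∈-allFin j) inc)))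

      leaf-arc⊆near : ∀ e → proj₁ (leaf-of e) ≡ v → tail D e ∈ near × head D e ∈ near
      leaf-arc⊆near e at-v = near⁺ (here refl) , near⁺ (there (here refl))
        where
        near⁺ : ∀ {y} → y ∈ tail D e ∷ head D e ∷ [] → y ∈ near
        near⁺ y∈ = ∈-++⁺ʳ near-cuts (∈-concat⁺′ y∈ (∈-map⁺ _ (arcs-at-complete v e at-v)))

      near-short : length near < N
      near-short = ≤-trans (s≤s (subst (_≤ 3 * n + 2) (sym (length-++ near-cuts))
                                  (+-mono-≤ cut-part leaf-part)))
                           N-large
        where
        cut-part : length near-cuts ≤ 3 * n
        cut-part = ≤-trans (length-concatMap-≤ cut-boundary (λ j → <⇒≤ (thin j)) (filter (incident? v) (allFin l)))
                           (*-monoˡ-≤ n (subst (_≤ 3) (degree-as-count v) (maxdeg v)))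
        leaf-part : length near-leaf ≤ 2
        leaf-part = ≤-trans (length-concatMap-≤ _ (λ _ → ≤-refl) (arcs-at v)) (*-monoˡ-≤ 2 (length-arcs-at v))

      far : Fin 2 → Fin N
      far c = proj₁ (missing-from-short-list (inner c) (inner-injective c) near near-short)

      far∉near : ∀ c → inner c (far c) ∈ near → ⊥
      far∉near c = proj₂ (missing-from-short-list (inner c) (inner-injective c) near near-short)

      free : Fin (nE D)
      free = arc (suc zero) (far zero) (far (suc zero))

      tail-free : tail D free ≡ inner zero (far zero)
      tail-free = tail-arc (suc zero) (far zero) (far (suc zero))

      head-free : head D free ≡ inner (suc zero) (far (suc zero))
      head-free = head-arc (suc zero) (far zero) (far (suc zero))

      free-untouched : ∀ j → Incident j v → ¬ Cut.Touches j free
      free-untouched j inc (inj₁ b) = far∉near zero (boundary⊆near j inc (subst (Cut.Boundary j) tail-free b))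
      free-untouched j inc (inj₂ b) = far∉near (suc zero) (boundary⊆near j inc (subst (Cut.Boundary j) head-free b))

      beyond-absurd : ∀ j → Beyond v j free → ⊥
      beyond-absurd j (inj₁ (e₁ , inside)) = inside-absurd (sink-side j (inj₁ e₁))
        where
        inside-absurd : (Cut.Small j × end₁ j ≡ v) ⊎ (¬ Cut.Small j × end₂ j ≡ v) → ⊥
        inside-absurd (inj₁ (small , _)) = free-untouched j (inj₁ e₁) (small free inside)
        inside-absurd (inj₂ (_ , e₂))    = tree-loopless tree j (trans e₁ (sym e₂))
      beyond-absurd j (inj₂ (e₂ , outside)) = outside-absurd (sink-side j (inj₂ e₂))
        where
        outside-absurd : (Cut.Small j × end₁ j ≡ v) ⊎ (¬ Cut.Small j × end₂ j ≡ v) → ⊥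
        outside-absurd (inj₁ (_ , e₁))     = tree-loopless tree j (trans e₁ (sym e₂))
        outside-absurd (inj₂ (¬small , _)) = ¬small (free-arc∉⇒small (side? j)
          (λ b → free-untouched j (inj₂ e₂) (inj₁ (subst (Cut.Boundary j) (sym tail-free) b)))
          (λ b → free-untouched j (inj₂ e₂) (inj₂ (subst (Cut.Boundary j) (sym head-free) b)))
          outside)

      placement-absurd : proj₁ (leaf-of free) ≡ v ⊎ ∃ (λ j → Beyond v j free) → ⊥
      placement-absurd (inj₁ at-v)  = far∉near zero (subst (_∈ near) tail-free (proj₁ (leaf-arc⊆near free at-v)))
      placement-absurd (inj₂ (j , b)) = beyond-absurd j b

      absurd : ⊥
      absurd = placement-absurd (placement v free)

    width-≥ : BranchDecomposition.widthAtLeast T n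
    width-≥ with any? (λ j → n ≤? length (cut-boundary j))
    ... | yes (j , wide) = inj₂ (j , injection-from-filter (Cut.boundary? j) wide)
    ... | no ¬wide       = ⊥-elim (Thin.absurd (λ j → ≰⇒> (λ wide → ¬wide (j , wide))))

mainTheorem6 : (n : ℕ) → Σ Digraph (λ D → Acyclic D × dbwAtLeast D n)
mainTheorem6 n =
  D , acyclic , (caterpillar-decomposition D {pred (nE D)} refl , tt) , LowerBound.width-≥ n (3 + 3 * n) N-large
  where
  open Layered (3 + 3 * n)
  N-large : 3 * n + 2 < 3 + 3 * n
  N-large = s≤s (≤-reflexive (+-comm (3 * n) 2))
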